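{- Let $\Sigma$ be a finite ordered alphabet of size $\sigma$, $\$\notin\Sigma$, and let $T$ be a string of length $n\ge3$ with $T[1]=T[n]=\$$ and $T[2..n-1]\in\Sigma^*$. Let $\mathcal{M}_1$ be the set of minimal absent words $w$ for $T$ whose run-length encoding consists of a single run (i.e. $w=c^k$ for some $c\in\Sigma$, $k\ge1$). Then $|\mathcal{M}_1|=\sigma$.
   Context: A string $w\in\Sigma^*$ is a minimal absent word (MAW) for $T$ if $w$ does not occur as a substring of $T$ but every proper substring of $w$ occurs in $T$ (the empty string always occurs). -}

module Defs where

open import Data.Nat using (ℕ; _≥_; _≤_)
open import Data.Fin using (Fin)
open import Data.Maybe using (Maybe; just; nothing)
open import Data.List using (List; []; _∷_; _++_; [_]; map; replicate; length)
open import Data.Product using (Σ; ∃; _×_; ∃-syntax)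
open import Relation.Binary.PropositionalEquality using (_≡_; _≢_)
open import Relation.Nullary using (¬_)

-- Ordered alphabet Σ of size σ is Fin σ (ordered by Fin's order).
-- The extended alphabet Σ ∪ {$} is Maybe (Fin σ), with $ = nothing.
Letter : ℕ → Set
Letter σ = Maybe (Fin σ)

$ : ∀ {σ} → Letter σ
$ = nothing

_⊑_ : ∀ {A : Set} → List A → List A → Set
x ⊑ y = ∃[ u ] ∃[ v ] (u ++ x ++ v ≡ y)

Occurs : ∀ {A : Set} → List A → List A → Set
Occurs x T = x ⊑ T

IsMAW : ∀ {A : Set} → List A → List A → Set
IsMAW T w = ¬ Occurs w T × (∀ x → x ⊑ w → x ≢ w → Occurs x T)

SingleRun : ∀ {σ} → List (Letter σ) → Set
SingleRun {σ} w = ∃[ c ] ∃[ k ] (k ≥ 1 × w ≡ replicate k (just {A = Fin σ} c))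

InM1 : ∀ {σ} → List (Letter σ) → List (Letter σ) → Set
InM1 T w = IsMAW T w × SingleRun w

text : ∀ {σ} → List (Fin σ) → List (Letter σ)
text S = $ ∷ (map just S ++ [ $ ])

-- For each letter c let m_c be the length of the longest run c^m_c occurring in T
-- (it exists since c^0 = ε occurs and runs are bounded by |T|). The proper factors
-- of c^(k+1) are exactly the c^j with j ≤ k, so c^(k+1) is a MAW iff c^k occurs and
-- c^(k+1) does not, i.e. iff k = m_c. Hence 𝓜₁ = { c^(m_c+1) | c ∈ Σ } has σ elements.
module Submission where

open import Defs
open import Data.Nat using (ℕ; zero; suc; _≥_; _≤_; s≤s; z≤n)
open import Data.Nat.Properties using (<-cmp; <-irrefl; ≤-refl; n≤1+n; m≤n⇒m<n∨m≡n)
open import Data.Fin using (Fin; _≟_)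
open import Data.List using (List; []; _∷_; _++_; length; replicate; map; allFin)
open import Data.List.Properties using (length-replicate; length-map; length-tabulate)
open import Data.List.Membership.Propositional using (_∈_)
open import Data.List.Membership.Propositional.Properties using (∈-map⁺; ∈-map⁻; ∈-allFin)
open import Data.List.Relation.Unary.All using (All)
open import Data.List.Relation.Unary.All.Properties using (++⁻ˡ; ++⁻ʳ; replicate⁺)
open import Data.List.Relation.Unary.Unique.Propositional using (Unique)
open import Data.List.Relation.Unary.Unique.Propositional.Properties using (map⁺; allFin⁺)
open import Data.List.Relation.Binary.Pointwise using (Pointwise-≡⇒≡; ≡⇒Pointwise-≡)
open import Data.List.Relation.Binary.Infix.Heterogeneous using (Infix; MkView; toView; fromView)
import Data.List.Relation.Binary.Infix.Heterogeneous.Properties as Infix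
open import Data.Maybe using (just)
open import Data.Maybe.Properties using (≡-dec)
open import Data.Product using (_×_; _,_; proj₁; proj₂; ∃-syntax)
open import Data.Sum using (inj₁; inj₂)
open import Function using (id)
open import Function.Bundles using (_⇔_; mk⇔; Equivalence)
open import Relation.Nullary using (¬_; Dec; yes; no; contradiction)
open import Relation.Nullary.Decidable using (map′)
open import Relation.Unary using (Decidable)
open import Relation.Binary.Definitions using (DecidableEquality; tri<; tri≈; tri>)
open import Relation.Binary.PropositionalEquality using (_≡_; _≢_; refl; sym; trans; cong; subst; subst₂)

module _ {A : Set} where

  ⊑⇒Infix : {x y : List A} → x ⊑ y → Infix _≡_ x y
  ⊑⇒Infix (u , v , refl) = fromView (MkView u (≡⇒Pointwise-≡ refl) v)

  Infix⇒⊑ : {x y : List A} → Infix _≡_ x y → x ⊑ y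
  Infix⇒⊑ p with MkView u pw v ← toView p with refl ← Pointwise-≡⇒≡ pw = u , v , refl

  ⊑-trans : {x y z : List A} → x ⊑ y → y ⊑ z → x ⊑ z
  ⊑-trans p q = Infix⇒⊑ (Infix.trans trans (⊑⇒Infix p) (⊑⇒Infix q))

  ⊑-length : {x y : List A} → x ⊑ y → length x ≤ length y
  ⊑-length p = Infix.length-mono (⊑⇒Infix p)

  ⊑? : DecidableEquality A → (x y : List A) → Dec (x ⊑ y)
  ⊑? _≟A_ x y = map′ Infix⇒⊑ ⊑⇒Infix (Infix.infix? _≟A_ x y)

  replicate-⊑ : {j k : ℕ} (a : A) → j ≤ k → replicate j a ⊑ replicate k a
  replicate-⊑ a j≤k = Infix⇒⊑ (Infix.replicate⁺ j≤k refl)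

  ⊑-replicate : {x : List A} {k : ℕ} (a : A) → x ⊑ replicate k a → ∃[ j ] (x ≡ replicate j a)
  ⊑-replicate {x} {k} a (u , v , eq) = _ , All-≡⇒replicate (++⁻ˡ x (++⁻ʳ u u++x++v-constant))
    where
    u++x++v-constant : All (_≡ a) (u ++ x ++ v)
    u++x++v-constant = subst (All (_≡ a)) (sym eq) (replicate⁺ k refl)

    All-≡⇒replicate : {x : List A} → All (_≡ a) x → x ≡ replicate (length x) a
    All-≡⇒replicate All.[] = refl
    All-≡⇒replicate (refl All.∷ ps) = cong (a ∷_) (All-≡⇒replicate ps)

  replicate-length-mono : {j k : ℕ} {a b : A} → replicate j a ⊑ replicate k b → j ≤ k
  replicate-length-mono {j} {k} p =
    subst₂ _≤_ (length-replicate j) (length-replicate k) (⊑-length p)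

lastBefore : {P : ℕ → Set} → Decidable P → P 0 → ∀ n → ¬ P (suc n) → ∃[ m ] (P m × ¬ P (suc m))
lastBefore P? p₀ n ¬pₙ₊₁ with P? n
... | yes pₙ = n , pₙ , ¬pₙ₊₁
lastBefore P? p₀ zero    ¬pₙ₊₁ | no ¬pₙ = contradiction p₀ ¬pₙ
lastBefore P? p₀ (suc n) ¬pₙ₊₁ | no ¬pₙ = lastBefore P? p₀ n ¬pₙ

module _ {A : Set} (T : List A) (a : A) where

  IsLongestRun : ℕ → Set
  IsLongestRun m = replicate m a ⊑ T × ¬ replicate (suc m) a ⊑ T

  longestRun : DecidableEquality A → ∃[ m ] IsLongestRun m
  longestRun _≟A_ = lastBefore (λ m → ⊑? _≟A_ (replicate m a) T) ([] , T , refl) (length T) too-long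
    where
    too-long : ¬ replicate (suc (length T)) a ⊑ T
    too-long p = <-irrefl refl (subst (_≤ length T) (length-replicate (suc (length T))) (⊑-length p))

  IsLongestRun-unique : ∀ {m n} → IsLongestRun m → IsLongestRun n → m ≡ n
  IsLongestRun-unique {m} {n} (occₘ , ¬occₘ₊₁) (occₙ , ¬occₙ₊₁) with <-cmp m n
  ... | tri< m<n _ _ = contradiction (⊑-trans (replicate-⊑ a m<n) occₙ) ¬occₘ₊₁
  ... | tri≈ _ m≡n _ = m≡n
  ... | tri> _ _ n<m = contradiction (⊑-trans (replicate-⊑ a n<m) occₘ) ¬occₙ₊₁

  IsMAW-replicate⇔IsLongestRun : ∀ k → IsMAW T (replicate (suc k) a) ⇔ IsLongestRun k
  IsMAW-replicate⇔IsLongestRun k = mk⇔ to from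
    where
    to : IsMAW T (replicate (suc k) a) → IsLongestRun k
    to (¬occ , proper) = proper _ (replicate-⊑ a (n≤1+n k)) shorter , ¬occ
      where
      shorter : replicate k a ≢ replicate (suc k) a
      shorter eq = <-irrefl refl (replicate-length-mono (subst (_⊑ replicate k a) eq (replicate-⊑ a ≤-refl)))

    from : IsLongestRun k → IsMAW T (replicate (suc k) a)
    from (occ , ¬occ) = ¬occ , proper
      where
      proper : ∀ x → x ⊑ replicate (suc k) a → x ≢ replicate (suc k) a → Occurs x T
      proper x x⊑ x≢ with ⊑-replicate a x⊑
      ... | j , refl with m≤n⇒m<n∨m≡n (replicate-length-mono x⊑)
      ...   | inj₁ (s≤s j≤k) = ⊑-trans (replicate-⊑ a j≤k) occ
      ...   | inj₂ j≡1+k = contradiction (cong (λ i → replicate i a) j≡1+k) x≢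

module MinimalAbsentRuns {σ : ℕ} (T : List (Letter σ)) where

  private
    longestRunOf : (c : Fin σ) → ∃[ m ] IsLongestRun T (just c) m
    longestRunOf c = longestRun T (just c) (≡-dec _≟_)

  runLength : Fin σ → ℕ
  runLength c = proj₁ (longestRunOf c)

  runLength-IsLongestRun : ∀ c → IsLongestRun T (just c) (runLength c)
  runLength-IsLongestRun c = proj₂ (longestRunOf c)

  minimalAbsentRun : Fin σ → List (Letter σ)
  minimalAbsentRun c = replicate (suc (runLength c)) (just c)

  minimalAbsentRun-injective : ∀ {c d} → minimalAbsentRun c ≡ minimalAbsentRun d → c ≡ d
  minimalAbsentRun-injective refl = refl

  ∈-minimalAbsentRuns⇔InM1 : ∀ w → (w ∈ map minimalAbsentRun (allFin σ)) ⇔ InM1 T w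
  ∈-minimalAbsentRuns⇔InM1 w = mk⇔ to from
    where
    to : w ∈ map minimalAbsentRun (allFin σ) → InM1 T w
    to w∈ with ∈-map⁻ minimalAbsentRun w∈
    ... | c , _ , refl =
      Equivalence.from (IsMAW-replicate⇔IsLongestRun T (just c) _) (runLength-IsLongestRun c) ,
      c , suc (runLength c) , s≤s z≤n , refl

    from : InM1 T w → w ∈ map minimalAbsentRun (allFin σ)
    from (maw , c , suc k , _ , refl)
      with refl ← IsLongestRun-unique T (just c) (runLength-IsLongestRun c)
                    (Equivalence.to (IsMAW-replicate⇔IsLongestRun T (just c) k) maw)
      = ∈-map⁺ minimalAbsentRun (∈-allFin c)

lemma1 : (σ : ℕ) (S : List (Fin σ)) → length (text S) ≥ 3 →
    ∃[ M1 ] (Unique M1 × length M1 ≡ σ × (∀ w → (w ∈ M1) ⇔ InM1 (text S) w))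
lemma1 σ S _ =
  map minimalAbsentRun (allFin σ) ,
  map⁺ minimalAbsentRun-injective (allFin⁺ σ) ,
  trans (length-map minimalAbsentRun (allFin σ)) (length-tabulate id) ,
  ∈-minimalAbsentRuns⇔InM1
  where open MinimalAbsentRuns (text S)
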